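{- Let $n\ge 3$ and let $C_n^\sigma=(C_n,\sigma)$ be a distance compatible signed cycle. Then $\dim(C_n^\sigma)=1$ if and only if there exists a vertex $u$ with $d^\pm(u)=0$ such that for every $k=1,2,\dots,\lfloor n/2\rfloor$ and all distinct $v,w\in N_k(u)$ we have $\sigma(uv)\neq\sigma(uw)$.
   Context: A signed graph is $\Sigma=(G,\sigma)$ with $\sigma:E(G)\to\{+1,-1\}$. The sign of a path is the product of its edge signs; $d$ is the distance in $G$. $\Sigma$ is distance compatible if for all vertices $u,v$ all shortest $u$–$v$ paths have the same sign, denoted $\sigma(uv)$ (for an edge this is the edge sign); then $d_\Sigma(u,v)=\sigma(uv)d(u,v)$. $d^+(v)$ and $d^-(v)$ are the numbers of positive and negative edges at $v$, and $d^\pm(v)=d^+(v)-d^-(v)$ is the net-degree. $N_k(v)=\{x: d(x,v)=k\}$ (i.e. $d_\Sigma(x,v)=\pm k$). For an ordered vertex set $W=(w_1,\dots,w_k)$, $r(v|W)=(d_\Sigma(v,w_1),\dots,d_\Sigma(v,w_k))$; $W$ is resolving if distinct vertices have distinct representations; $\dim$ is the minimum cardinality of a resolving set. -}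

module Defs where

open import Data.Nat using (ℕ; zero; suc; _+_; _≤_)
open import Data.Nat.DivMod using (_%_; m%n<n)
open import Data.Fin using (Fin; toℕ; fromℕ<; _≟_)
open import Data.List using (List; length; map; filter; foldr)
open import Data.List.Membership.Propositional using (_∈_)
open import Data.Integer as ℤ using (ℤ)
open import Data.Product using (Σ; ∃; _×_)
open import Data.Sum using (_⊎_)
open import Data.List.Base using (allFin)
open import Relation.Binary.PropositionalEquality using (_≡_; _≢_)
open import Relation.Nullary.Decidable using (_⊎-dec_)

data Sign : Set where
  pos neg : Sign

_·_ : Sign → Sign → Sign
pos · s = s
neg · pos = neg
neg · neg = pos

signℤ : Sign → ℤ
signℤ pos = ℤ.+ 1
signℤ neg = ℤ.- (ℤ.+ 1)

next : ∀ {n} → Fin n → Fin n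
next {suc m} i = fromℕ< (m%n<n (suc (toℕ i)) (suc m))

-- A signed cycle is given by σ : Fin n → Sign, the sign of edge {i, next i}.
-- Walks in the signed cycle (each step traverses one edge, either direction).
data Walk {n : ℕ} (σ : Fin n → Sign) : Fin n → Fin n → Set where
  nil : ∀ u → Walk σ u u
  fwd : ∀ i {v} → Walk σ (next i) v → Walk σ i v
  bwd : ∀ i {v} → Walk σ i v → Walk σ (next i) v

len : ∀ {n} {σ : Fin n → Sign} {u v} → Walk σ u v → ℕ
len (nil _) = 0
len (fwd _ p) = suc (len p)
len (bwd _ p) = suc (len p)

wsign : ∀ {n} {σ : Fin n → Sign} {u v} → Walk σ u v → Sign
wsign (nil _) = pos
wsign {σ = σ} (fwd i p) = σ i · wsign p
wsign {σ = σ} (bwd i p) = σ i · wsign p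

Shortest : ∀ {n} {σ : Fin n → Sign} {u v} → Walk σ u v → Set
Shortest {σ = σ} {u} {v} p = ∀ (q : Walk σ u v) → len p ≤ len q

IsDist : ∀ {n} (σ : Fin n → Sign) → Fin n → Fin n → ℕ → Set
IsDist σ u v k = Σ (Walk σ u v) (λ p → len p ≡ k) × (∀ (q : Walk σ u v) → k ≤ len q)

DistCompat : ∀ {n} (σ : Fin n → Sign) → Set
DistCompat σ = ∀ u v (p q : Walk σ u v) → Shortest p → Shortest q → wsign p ≡ wsign q

SDist : ∀ {n} (σ : Fin n → Sign) → Fin n → Fin n → ℤ → Set
SDist σ u v z = Σ (Walk σ u v) (λ p → Shortest p × z ≡ signℤ (wsign p) ℤ.* ℤ.+ (len p))

SameSD : ∀ {n} (σ : Fin n → Sign) → Fin n → Fin n → Fin n → Set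
SameSD σ x y w = ∀ a b → SDist σ x w a → SDist σ y w b → a ≡ b

Resolving : ∀ {n} (σ : Fin n → Sign) → List (Fin n) → Set
Resolving σ W = ∀ x y → (∀ w → w ∈ W → SameSD σ x y w) → x ≡ y

HasDim : ∀ {n} (σ : Fin n → Sign) → ℕ → Set
HasDim σ k = Σ (List (Fin _)) (λ W → length W ≡ k × Resolving σ W)
           × (∀ W → Resolving σ W → k ≤ length W)

-- net-degree d^±(u) = d^+(u) - d^-(u): sum of ±1 over the edges incident to u
netDeg : ∀ {n} (σ : Fin n → Sign) → Fin n → ℤ
netDeg {n} σ u = foldr ℤ._+_ (ℤ.+ 0) (map (λ i → signℤ (σ i))
                   (filter (λ i → (i ≟ u) ⊎-dec (next i ≟ u)) (allFin n)))

-- σ(uv) ≠ σ(uw): the shortest u-v paths and shortest u-w paths have different signs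
SignsDiffer : ∀ {n} (σ : Fin n → Sign) → Fin n → Fin n → Fin n → Set
SignsDiffer σ u v w = ∀ (p : Walk σ u v) (q : Walk σ u w) → Shortest p → Shortest q → wsign p ≢ wsign q

module Submission where

-- A single vertex u resolves the signed cycle iff no two distinct vertices have the same signed
-- distance from u. Vertices at distance 0 are u itself, and on a cycle every distance is at most
-- ⌊n/2⌋; two vertices at the same distance k ≥ 1 have equal signed distances exactly when their
-- shortest paths from u carry the same sign. Hence u resolves iff the sign condition holds for every
-- k. The net-degree condition is its instance k = 1: the two neighbours of u are at distance 1,
-- so the two edges at u have opposite signs.

open import Defs
open import Data.Empty using (⊥; ⊥-elim)
open import Data.Fin as Fin using (Fin; toℕ; fromℕ<; _≟_)
open import Data.Fin.Properties using (toℕ-injective; toℕ-fromℕ<; toℕ<n; any?)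
open import Data.Integer as ℤ using (ℤ; 0ℤ; +_)
import Data.Integer.Properties as ℤ
open import Data.List using ([]; _∷_; length; filter; foldr; allFin)
open import Data.List.Membership.Propositional using (_∈_)
open import Data.List.Membership.Propositional.Properties using (∈-allFin; ∈-filter⁺; ∈-filter⁻)
open import Data.List.Membership.Propositional.Properties.WithK using (unique∧set⇒bag)
open import Data.List.Relation.Binary.BagAndSetEquality using (∼bag⇒↭)
open import Data.List.Relation.Binary.Permutation.Propositional using (_↭_; ↭⇒↭ₛ)
open import Data.List.Relation.Binary.Permutation.Propositional.Properties using (map⁺)
open import Data.List.Relation.Binary.Permutation.Setoid.Properties using (foldr-commMonoid)
open import Data.List.Relation.Unary.All using ([]; _∷_)
open import Data.List.Relation.Unary.AllPairs using ([]; _∷_)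
open import Data.List.Relation.Unary.Any using (here; there)
open import Data.List.Relation.Unary.Unique.Propositional.Properties using (allFin⁺; filter⁺)
open import Data.Nat using (ℕ; zero; suc; _+_; _*_; _∸_; _≤_; _<_; _/_; _%_; z≤n; s≤s; _≤?_; _<?_; NonZero)
open import Data.Nat.DivMod using (m%n<n; m≡m%n+[m/n]*n; [m+n]%n≡m%n; m<n⇒m%n≡m; m≤n⇒[n∸m]%m≡n%m; %-distribˡ-+; m%n%n≡m%n)
open import Data.Nat.Induction using (<-wellFounded)
open import Data.Nat.Properties
  using (≤-trans; ≤-antisym; <⇒≤; ≰⇒>; ≮⇒≥; <-irrefl; n≢0⇒n>0; m+1+n≢m;
         +-comm; +-identityʳ; +-suc; +-cancelˡ-≡; +-mono-<; +-monoˡ-≤; *-comm;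
         m∸n≤m; m+n∸m≡n; m+[n∸m]≡n; suc-injective; m∸n+n≡m; m≤n+o⇒m∸n≤o; m<n+o⇒m∸n<o; ≤-pred; module ≤-Reasoning)
open import Data.Product using (Σ; ∃; _×_; _,_; proj₁; proj₂)
open import Data.Sum using (_⊎_; inj₁; inj₂; [_,_])
open import Function.Bundles using (_⇔_; mk⇔)
open import Induction.WellFounded using (Acc; acc)
open import Level using (0ℓ)
open import Relation.Binary.PropositionalEquality using (_≡_; _≢_; refl; sym; trans; cong; cong₂; subst; subst₂; setoid; module ≡-Reasoning)
open import Relation.Nullary using (Dec; yes; no)
open import Relation.Nullary.Decidable using (_⊎-dec_; _×-dec_)
open import Relation.Unary using (Pred; Decidable)

·-assoc : ∀ a b c → (a · b) · c ≡ a · (b · c)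
·-assoc pos b c = refl
·-assoc neg pos c = refl
·-assoc neg neg pos = refl
·-assoc neg neg neg = refl

·-comm : ∀ a b → a · b ≡ b · a
·-comm pos pos = refl
·-comm pos neg = refl
·-comm neg pos = refl
·-comm neg neg = refl

·-identityʳ : ∀ a → a · pos ≡ a
·-identityʳ pos = refl
·-identityʳ neg = refl

signℤ-+-≢ : ∀ {s t} → s ≢ t → signℤ s ℤ.+ signℤ t ≡ 0ℤ
signℤ-+-≢ {pos} {pos} s≢t = ⊥-elim (s≢t refl)
signℤ-+-≢ {pos} {neg} _ = refl
signℤ-+-≢ {neg} {pos} _ = refl
signℤ-+-≢ {neg} {neg} s≢t = ⊥-elim (s≢t refl)

signed : Sign → ℕ → ℤ
signed s l = signℤ s ℤ.* + l

signed-injective : ∀ s t l k → signed s l ≡ signed t k → l ≡ k × (l ≡ 0 ⊎ s ≡ t)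
signed-injective s t l k eq =
  injective s t l k (trans (sym (signed≡signed′ s l)) (trans eq (signed≡signed′ t k)))
  where
  signed′ : Sign → ℕ → ℤ
  signed′ pos l = + l
  signed′ neg l = ℤ.- + l

  signed≡signed′ : ∀ s l → signed s l ≡ signed′ s l
  signed≡signed′ pos l = ℤ.*-identityˡ (+ l)
  signed≡signed′ neg l = ℤ.-1*i≡-i (+ l)

  injective : ∀ s t l k → signed′ s l ≡ signed′ t k → l ≡ k × (l ≡ 0 ⊎ s ≡ t)
  injective pos pos l k eq = ℤ.+-injective eq , inj₂ refl
  injective neg neg l k eq = ℤ.+-injective (ℤ.neg-injective eq) , inj₂ refl
  injective pos neg zero zero _ = refl , inj₁ refl
  injective neg pos zero zero _ = refl , inj₁ refl
  injective pos neg (suc _) zero ()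
  injective pos neg zero (suc _) ()
  injective neg pos (suc _) zero ()
  injective neg pos zero (suc _) ()

foldr-+-↭ : ∀ {xs ys} → xs ↭ ys → foldr ℤ._+_ 0ℤ xs ≡ foldr ℤ._+_ 0ℤ ys
foldr-+-↭ xs↭ys = foldr-commMonoid (setoid ℤ) ℤ.+-0-isCommutativeMonoid (↭⇒↭ₛ xs↭ys)

filter-allFin-↭ : ∀ {n} {P : Pred (Fin n) 0ℓ} (P? : Decidable P) {a b : Fin n} → a ≢ b →
                  (∀ x → P x → x ≡ a ⊎ x ≡ b) → P a → P b → filter P? (allFin n) ↭ a ∷ b ∷ []
filter-allFin-↭ {n} P? a≢b only-a-b Pa Pb =
  ∼bag⇒↭ (unique∧set⇒bag (filter⁺ P? (allFin⁺ n)) ((a≢b ∷ []) ∷ [] ∷ []) (mk⇔ to from))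
  where
  to : ∀ {x} → x ∈ filter P? (allFin n) → x ∈ _
  to x∈ with only-a-b _ (proj₂ (∈-filter⁻ P? {xs = allFin n} x∈))
  ... | inj₁ x≡a = here x≡a
  ... | inj₂ x≡b = there (here x≡b)

  from : ∀ {x} → x ∈ _ → x ∈ filter P? (allFin n)
  from (here refl) = ∈-filter⁺ P? (∈-allFin _) Pa
  from (there (here refl)) = ∈-filter⁺ P? (∈-allFin _) Pb

+≡⇒≤half⊎≤half : ∀ {i j o} → i + j ≡ o → i ≤ o / 2 ⊎ j ≤ o / 2
+≡⇒≤half⊎≤half {i} {j} {o} i+j≡o with i ≤? o / 2
... | yes i≤ = inj₁ i≤
... | no i≰ = inj₂ (subst (_≤ o / 2) j≡o∸i (m≤n+o⇒m∸n≤o o i o≤i+half))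
  where
  open ≤-Reasoning
  j≡o∸i : o ∸ i ≡ j
  j≡o∸i = trans (cong (_∸ i) (sym i+j≡o)) (m+n∸m≡n i j)
  o≤i+half : o ≤ i + o / 2
  o≤i+half = begin
    o                       ≡⟨ m≡m%n+[m/n]*n o 2 ⟩
    o % 2 + o / 2 * 2       ≤⟨ +-monoˡ-≤ (o / 2 * 2) (≤-pred (m%n<n o 2)) ⟩
    suc (o / 2 * 2)         ≡⟨ cong suc (trans (*-comm (o / 2) 2) (cong (λ z → o / 2 + z) (+-identityʳ (o / 2)))) ⟩
    suc (o / 2) + o / 2     ≤⟨ +-monoˡ-≤ (o / 2) (≰⇒> i≰) ⟩
    i + o / 2               ∎

[m%o+n]%o≡[m+n]%o : ∀ m n o .{{_ : NonZero o}} → (m % o + n) % o ≡ (m + n) % o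
[m%o+n]%o≡[m+n]%o m n o = begin
  (m % o + n) % o         ≡⟨ %-distribˡ-+ (m % o) n o ⟩
  (m % o % o + n % o) % o ≡⟨ cong (λ t → (t + n % o) % o) (m%n%n≡m%n m o) ⟩
  (m % o + n % o) % o     ≡⟨ %-distribˡ-+ m n o ⟨
  (m + n) % o             ∎
  where open ≡-Reasoning

[m+n]%o≢m : ∀ {m n o} .{{_ : NonZero o}} → m < o → 0 < n → n < o → (m + n) % o ≢ m
[m+n]%o≢m {m} {suc n′} {o} m<o _ n<o eq with m + suc n′ <? o
... | yes m+n<o = m+1+n≢m m (trans (sym (m<n⇒m%n≡m m+n<o)) eq)
... | no m+n≮o = <-irrefl (+-cancelˡ-≡ m _ _ m+n≡m+o) n<o
  where
  o≤m+n = ≮⇒≥ m+n≮o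
  -- past o the sum wraps around exactly once, since m + n < 2o
  wrapped≡m : m + suc n′ ∸ o ≡ m
  wrapped≡m = trans (sym (m<n⇒m%n≡m (m<n+o⇒m∸n<o (m + suc n′) o (+-mono-< m<o n<o))))
                    (trans (m≤n⇒[n∸m]%m≡n%m o≤m+n) eq)
  m+n≡m+o : m + suc n′ ≡ m + o
  m+n≡m+o = trans (sym (m∸n+n≡m o≤m+n)) (cong (_+ o) wrapped≡m)

module Walks {n : ℕ} (σ : Fin n → Sign) where

  infixr 5 _++ʷ_

  _++ʷ_ : ∀ {x y z} → Walk σ x y → Walk σ y z → Walk σ x z
  nil _ ++ʷ q = q
  fwd i p ++ʷ q = fwd i (p ++ʷ q)
  bwd i p ++ʷ q = bwd i (p ++ʷ q)

  len-++ʷ : ∀ {x y z} (p : Walk σ x y) (q : Walk σ y z) → len (p ++ʷ q) ≡ len p + len q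
  len-++ʷ (nil _) q = refl
  len-++ʷ (fwd i p) q = cong suc (len-++ʷ p q)
  len-++ʷ (bwd i p) q = cong suc (len-++ʷ p q)

  wsign-++ʷ : ∀ {x y z} (p : Walk σ x y) (q : Walk σ y z) → wsign (p ++ʷ q) ≡ wsign p · wsign q
  wsign-++ʷ (nil _) q = refl
  wsign-++ʷ (fwd i p) q = trans (cong (σ i ·_) (wsign-++ʷ p q)) (sym (·-assoc (σ i) _ _))
  wsign-++ʷ (bwd i p) q = trans (cong (σ i ·_) (wsign-++ʷ p q)) (sym (·-assoc (σ i) _ _))

  reverse : ∀ {x y} → Walk σ x y → Walk σ y x
  reverse (nil x) = nil x
  reverse (fwd i p) = reverse p ++ʷ bwd i (nil i)
  reverse (bwd i p) = reverse p ++ʷ fwd i (nil _)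

  len-reverse : ∀ {x y} (p : Walk σ x y) → len (reverse p) ≡ len p
  len-reverse (nil _) = refl
  len-reverse (fwd i p) = trans (len-++ʷ (reverse p) _) (trans (+-comm _ 1) (cong suc (len-reverse p)))
  len-reverse (bwd i p) = trans (len-++ʷ (reverse p) _) (trans (+-comm _ 1) (cong suc (len-reverse p)))

  wsign-reverse : ∀ {x y} (p : Walk σ x y) → wsign (reverse p) ≡ wsign p
  wsign-reverse (nil _) = refl
  wsign-reverse (fwd i p) =
    trans (wsign-++ʷ (reverse p) _) (trans (cong₂ _·_ (wsign-reverse p) (·-identityʳ (σ i))) (·-comm _ (σ i)))
  wsign-reverse (bwd i p) =
    trans (wsign-++ʷ (reverse p) _) (trans (cong₂ _·_ (wsign-reverse p) (·-identityʳ (σ i))) (·-comm _ (σ i)))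

  reverse-shortest : ∀ {x y} {p : Walk σ x y} → Shortest p → Shortest (reverse p)
  reverse-shortest {p = p} sp q = subst₂ _≤_ (sym (len-reverse p)) (len-reverse q) (sp (reverse q))

  bwd-edge : ∀ {i x} → next i ≡ x → Σ (Walk σ x i) (λ p → len p ≡ 1 × wsign p ≡ σ i)
  bwd-edge refl = bwd _ (nil _) , refl , ·-identityʳ _

  len≡0⇒≡ : ∀ {x y} (p : Walk σ x y) → len p ≡ 0 → x ≡ y
  len≡0⇒≡ (nil _) _ = refl

  ≢⇒1≤len : ∀ {x y} → x ≢ y → (p : Walk σ x y) → 1 ≤ len p
  ≢⇒1≤len x≢y (nil _) = ⊥-elim (x≢y refl)
  ≢⇒1≤len _ (fwd _ _) = s≤s z≤n
  ≢⇒1≤len _ (bwd _ _) = s≤s z≤n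

  len≡1⇒shortest : ∀ {x y} → x ≢ y → (p : Walk σ x y) → len p ≡ 1 → Shortest p
  len≡1⇒shortest x≢y _ len≡1 q = subst (_≤ len q) (sym len≡1) (≢⇒1≤len x≢y q)

  shortest-len-unique : ∀ {x y} {p q : Walk σ x y} → Shortest p → Shortest q → len p ≡ len q
  shortest-len-unique {p = p} {q} sp sq = ≤-antisym (sp q) (sq p)

  shortest⇒IsDist : ∀ {x y} (p : Walk σ x y) → Shortest p → IsDist σ x y (len p)
  shortest⇒IsDist p sp = (p , refl) , sp

  IsDist-len : ∀ {x y k} → IsDist σ x y k → {p : Walk σ x y} → Shortest p → len p ≡ k
  IsDist-len ((q , len-q) , k≤) {p} sp = ≤-antisym (subst (len p ≤_) len-q (sp q)) (k≤ p)

  IsDist-sym : ∀ {x y k} → IsDist σ x y k → IsDist σ y x k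
  IsDist-sym ((p , len-p) , k≤) =
    (reverse p , trans (len-reverse p) len-p) , λ q → subst (_ ≤_) (len-reverse q) (k≤ (reverse q))

  WalkOfLength : Fin n → Fin n → ℕ → Set
  WalkOfLength x y k = Σ (Walk σ x y) (λ p → len p ≡ k)

  walkOfLength? : ∀ k x y → Dec (WalkOfLength x y k)
  walkOfLength? zero x y with x ≟ y
  ... | yes refl = yes (nil x , refl)
  ... | no x≢y = no λ (p , len≡0) → x≢y (len≡0⇒≡ p len≡0)
  walkOfLength? (suc k) x y with walkOfLength? k (next x) y | any? (λ i → (next i ≟ x) ×-dec walkOfLength? k i y)
  ... | yes (p , len-p) | _ = yes (fwd x p , cong suc len-p)
  ... | no _ | yes (i , refl , p , len-p) = yes (bwd i p , cong suc len-p)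
  ... | no no-fwd | no no-bwd = no λ where
    (fwd _ p , len-p) → no-fwd (p , suc-injective len-p)
    (bwd i p , len-p) → no-bwd (i , refl , p , suc-injective len-p)

  shortestWalk : ∀ {x y} → Walk σ x y → Σ (Walk σ x y) Shortest
  shortestWalk p = shorten p (<-wellFounded (len p))
    where
    shorten : ∀ {x y} (p : Walk σ x y) → Acc _<_ (len p) → Σ (Walk σ x y) Shortest
    shorten {x} {y} p (acc rec) with any? (λ (j : Fin (len p)) → walkOfLength? (toℕ j) x y)
    ... | yes (j , q , len-q) = shorten q (rec (subst (_< len p) (sym len-q) (toℕ<n j)))
    ... | no none = p , λ q → ≮⇒≥ (λ q<p → none (fromℕ< q<p , q , sym (toℕ-fromℕ< q<p)))

  Walk≤ : Fin n → Fin n → ℕ → Set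
  Walk≤ x y b = Σ (Walk σ x y) (λ p → len p ≤ b)

  reverse-walk≤ : ∀ {x y b} → Walk≤ x y b → Walk≤ y x b
  reverse-walk≤ (p , p≤b) = reverse p , subst (_≤ _) (sym (len-reverse p)) p≤b

  shortestWalk≤ : ∀ {x y b} → Walk≤ x y b → Σ (Walk σ x y) (λ p → Shortest p × len p ≤ b)
  shortestWalk≤ (p , p≤b) = let (q , sq) = shortestWalk p in q , sq , ≤-trans (sq p) p≤b

  SameSD⇒signed≡ : ∀ {x y u} → SameSD σ x y u → {p : Walk σ x u} {q : Walk σ y u} →
                   Shortest p → Shortest q →
                   signed (wsign p) (len p) ≡ signed (wsign q) (len q)
  SameSD⇒signed≡ same {p} {q} sp sq = same _ _ (p , sp , refl) (q , sq , refl)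

  Resolves : Fin n → Set
  Resolves u = ∀ x y → SameSD σ x y u → x ≡ y

  SignsDifferAt : Fin n → ℕ → Set
  SignsDifferAt u k = ∀ v w → v ≢ w → IsDist σ u v k → IsDist σ u w k → SignsDiffer σ u v w

  module _ (dc : DistCompat σ) where

    SDist⇒≡signed : ∀ {x y z} → SDist σ x y z → {p : Walk σ x y} → Shortest p →
                    z ≡ signed (wsign p) (len p)
    SDist⇒≡signed (q , sq , refl) sp = cong₂ signed (dc _ _ q _ sq sp) (shortest-len-unique sq sp)

    shortest⇒SameSD : ∀ {x y u} {p : Walk σ x u} {q : Walk σ y u} → Shortest p → Shortest q →
                      wsign p ≡ wsign q → len p ≡ len q → SameSD σ x y u
    shortest⇒SameSD sp sq signs lens a b da db =
      trans (SDist⇒≡signed da sp) (trans (cong₂ signed signs lens) (sym (SDist⇒≡signed db sq)))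

    resolves⇒signsDiffer : ∀ {u} → Resolves u → ∀ k → SignsDifferAt u k
    resolves⇒signsDiffer resolves k v w v≢w dv dw p q sp sq signs =
      v≢w (resolves v w (shortest⇒SameSD (reverse-shortest sp) (reverse-shortest sq) signs′ lens′))
      where
      signs′ : wsign (reverse p) ≡ wsign (reverse q)
      signs′ = trans (wsign-reverse p) (trans signs (sym (wsign-reverse q)))
      lens′ : len (reverse p) ≡ len (reverse q)
      lens′ = trans (len-reverse p) (trans (IsDist-len dv sp) (sym (trans (len-reverse q) (IsDist-len dw sq))))

  hasDim1⇒∃resolves : HasDim σ 1 → ∃ Resolves
  hasDim1⇒∃resolves (([] , () , _) , _)
  hasDim1⇒∃resolves ((_ ∷ _ ∷ _ , () , _) , _)
  hasDim1⇒∃resolves ((u ∷ [] , _ , resolving) , _) =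
    u , λ x y same → resolving x y λ { _ (here refl) → same }

  resolves⇒hasDim1 : ∀ {a b u} → a ≢ b → Resolves u → HasDim σ 1
  resolves⇒hasDim1 {a} {b} {u} a≢b resolves =
    (u ∷ [] , refl , λ x y same → resolves x y (same u (here refl))) , nonempty
    where
    nonempty : ∀ W → Resolving σ W → 1 ≤ length W
    nonempty [] resolving = ⊥-elim (a≢b (resolving a b λ _ ()))
    nonempty (_ ∷ _) _ = s≤s z≤n

module Cycle (m : ℕ) where

  N : ℕ
  N = suc m

  next^ : ℕ → Fin N → Fin N
  next^ zero x = x
  next^ (suc j) x = next^ j (next x)

  toℕ-next : ∀ x → toℕ (next x) ≡ suc (toℕ x) % N
  toℕ-next x = toℕ-fromℕ< (m%n<n (suc (toℕ x)) N)

  toℕ-next^ : ∀ j x → toℕ (next^ j x) ≡ (toℕ x + j) % N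
  toℕ-next^ zero x = sym (trans (cong (_% N) (+-identityʳ (toℕ x))) (m<n⇒m%n≡m (toℕ<n x)))
  toℕ-next^ (suc j) x = begin
    toℕ (next^ j (next x))    ≡⟨ toℕ-next^ j (next x) ⟩
    (toℕ (next x) + j) % N    ≡⟨ cong (λ t → (t + j) % N) (toℕ-next x) ⟩
    (suc (toℕ x) % N + j) % N ≡⟨ [m%o+n]%o≡[m+n]%o (suc (toℕ x)) j N ⟩
    (suc (toℕ x) + j) % N     ≡⟨ cong (_% N) (+-suc (toℕ x) j) ⟨
    (toℕ x + suc j) % N       ∎
    where open ≡-Reasoning

  next^-+ : ∀ i j x → next^ (i + j) x ≡ next^ j (next^ i x)
  next^-+ zero j x = refl
  next^-+ (suc i) j x = next^-+ i j (next x)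

  next^-N : ∀ x → next^ N x ≡ x
  next^-N x = toℕ-injective (trans (toℕ-next^ N x) (trans ([m+n]%n≡m%n (toℕ x) N) (m<n⇒m%n≡m (toℕ<n x))))

  next^-≢ : ∀ {j} x → 0 < j → j < N → next^ j x ≢ x
  next^-≢ {j} x 0<j j<N eq =
    [m+n]%o≢m {toℕ x} {j} {N} (toℕ<n x) 0<j j<N (trans (sym (toℕ-next^ j x)) (cong toℕ eq))

  prev : Fin N → Fin N
  prev = next^ m

  next-prev : ∀ x → next (prev x) ≡ x
  next-prev x = trans (sym (next^-+ m 1 x)) (trans (cong (λ j → next^ j x) (+-comm m 1)) (next^-N x))

  prev-next : ∀ x → prev (next x) ≡ x
  prev-next = next^-N

  next-≢ : 1 < N → ∀ x → next x ≢ x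
  next-≢ 1<N x = next^-≢ x (s≤s z≤n) 1<N

  next-≢-prev : 2 < N → ∀ x → next x ≢ prev x
  next-≢-prev 2<N x eq = next^-≢ (prev x) (s≤s z≤n) 2<N (trans (cong next (next-prev x)) eq)

  toℕ-≤⇒next^ : ∀ {x y} → toℕ x ≤ toℕ y → next^ (toℕ y ∸ toℕ x) x ≡ y
  toℕ-≤⇒next^ {x} {y} x≤y = toℕ-injective (begin
    toℕ (next^ (toℕ y ∸ toℕ x) x)    ≡⟨ toℕ-next^ (toℕ y ∸ toℕ x) x ⟩
    (toℕ x + (toℕ y ∸ toℕ x)) % N   ≡⟨ cong (_% N) (m+[n∸m]≡n x≤y) ⟩
    toℕ y % N                       ≡⟨ m<n⇒m%n≡m (toℕ<n y) ⟩
    toℕ y                           ∎)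
    where open ≡-Reasoning

  module _ (σ : Fin N → Sign) where
    open Walks σ

    forward : ∀ j x → Walk σ x (next^ j x)
    forward zero x = nil x
    forward (suc j) x = fwd x (forward j (next x))

    len-forward : ∀ j x → len (forward j x) ≡ j
    len-forward zero x = refl
    len-forward (suc j) x = cong suc (len-forward j (next x))

    forward-walk≤ : ∀ {j b} x → j ≤ b → Walk≤ x (next^ j x) b
    forward-walk≤ {j} x j≤b = forward j x , subst (_≤ _) (sym (len-forward j x)) j≤b

    -- The two arcs between x and next^ j x have lengths j and N ∸ j.
    next^-walk≤half : ∀ {j} x → j ≤ N → Walk≤ x (next^ j x) (N / 2)
    next^-walk≤half {j} x j≤N with +≡⇒≤half⊎≤half {j} {N ∸ j} (m+[n∸m]≡n j≤N)
    ... | inj₁ j≤half = forward-walk≤ x j≤half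
    ... | inj₂ rest≤half = reverse-walk≤ (subst (λ z → Walk≤ (next^ j x) z (N / 2)) back
                                               (forward-walk≤ {N ∸ j} (next^ j x) rest≤half))
      where
      back : next^ (N ∸ j) (next^ j x) ≡ x
      back = trans (sym (next^-+ j (N ∸ j) x)) (trans (cong (λ i → next^ i x) (m+[n∸m]≡n j≤N)) (next^-N x))

    walk≤half-ordered : ∀ {x y} → toℕ x ≤ toℕ y → Walk≤ x y (N / 2)
    walk≤half-ordered {x} {y} x≤y =
      subst (λ z → Walk≤ x z (N / 2)) (toℕ-≤⇒next^ x≤y)
            (next^-walk≤half x (≤-trans (m∸n≤m (toℕ y) (toℕ x)) (<⇒≤ (toℕ<n y))))

    walk≤half : ∀ x y → Walk≤ x y (N / 2)
    walk≤half x y with toℕ x ≤? toℕ y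
    ... | yes x≤y = walk≤half-ordered x≤y
    ... | no x≰y = reverse-walk≤ (walk≤half-ordered (<⇒≤ (≰⇒> x≰y)))

    netDeg-cycle : ∀ u → u ≢ prev u → netDeg σ u ≡ signℤ (σ u) ℤ.+ signℤ (σ (prev u))
    netDeg-cycle u u≢prev = begin
      netDeg σ u                  ≡⟨ foldr-+-↭ (map⁺ f incident-edges) ⟩
      f u ℤ.+ (f (prev u) ℤ.+ 0ℤ) ≡⟨ cong (ℤ._+_ (f u)) (ℤ.+-identityʳ (f (prev u))) ⟩
      f u ℤ.+ f (prev u)          ∎
      where
      open ≡-Reasoning
      f : Fin N → ℤ
      f i = signℤ (σ i)
      incident? : Decidable (λ i → i ≡ u ⊎ next i ≡ u)
      incident? i = (i ≟ u) ⊎-dec (next i ≟ u)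
      incident : ∀ i → i ≡ u ⊎ next i ≡ u → i ≡ u ⊎ i ≡ prev u
      incident i = [ inj₁ , (λ next-i≡u → inj₂ (trans (sym (prev-next i)) (cong prev next-i≡u))) ]
      incident-edges : filter incident? (allFin N) ↭ u ∷ prev u ∷ []
      incident-edges = filter-allFin-↭ incident? u≢prev incident (inj₁ refl) (inj₂ (next-prev u))

    signsDiffer₁⇒netDeg≡0 : 2 < N → ∀ u → SignsDifferAt u 1 → netDeg σ u ≡ 0ℤ
    signsDiffer₁⇒netDeg≡0 2<N u differ₁ with bwd-edge (next-prev u)
    ... | p , len-p , wsign-p = trans (netDeg-cycle u u≢prev) (signℤ-+-≢ σu≢σprev)
      where
      u≢next : u ≢ next u
      u≢next u≡next = next-≢ (<⇒≤ 2<N) u (sym u≡next)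
      u≢prev : u ≢ prev u
      u≢prev u≡prev = next-≢ (<⇒≤ 2<N) u (trans (cong next u≡prev) (next-prev u))
      q : Walk σ u (next u)
      q = fwd u (nil (next u))
      sq : Shortest q
      sq = len≡1⇒shortest u≢next q refl
      sp : Shortest p
      sp = len≡1⇒shortest u≢prev p len-p
      σu≢σprev : σ u ≢ σ (prev u)
      σu≢σprev σu≡σprev =
        differ₁ (next u) (prev u) (next-≢-prev 2<N u)
                (shortest⇒IsDist q sq) (subst (IsDist σ u (prev u)) len-p (shortest⇒IsDist p sp))
                q p sq sp (trans (·-identityʳ (σ u)) (trans σu≡σprev (sym wsign-p)))

    signsDiffer⇒resolves : ∀ {u} → (∀ k → 1 ≤ k → k ≤ N / 2 → SignsDifferAt u k) → Resolves u
    signsDiffer⇒resolves {u} differ x y same with x ≟ y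
    ... | yes x≡y = x≡y
    ... | no x≢y = ⊥-elim (distinguished (shortestWalk≤ (walk≤half x u)) (shortestWalk≤ (walk≤half y u)))
      where
      distinguished : Σ (Walk σ x u) (λ p → Shortest p × len p ≤ N / 2) →
                      Σ (Walk σ y u) (λ q → Shortest q × len q ≤ N / 2) → ⊥
      distinguished (p , sp , p≤half) (q , sq , _) =
        [ len≢0 , (λ signs → differ (len p) (n≢0⇒n>0 len≢0) p≤half x y x≢y dx dy _ _
                               (reverse-shortest sp) (reverse-shortest sq) (signs′ signs)) ] len≡0⊎signs
        where
        injective = signed-injective (wsign p) (wsign q) (len p) (len q) (SameSD⇒signed≡ same sp sq)
        lens = proj₁ injective
        len≡0⊎signs = proj₂ injective
        len≢0 : len p ≢ 0
        len≢0 len≡0 = x≢y (trans (len≡0⇒≡ p len≡0) (sym (len≡0⇒≡ q (trans (sym lens) len≡0))))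
        dx : IsDist σ u x (len p)
        dx = IsDist-sym (shortest⇒IsDist p sp)
        dy : IsDist σ u y (len p)
        dy = subst (IsDist σ u y) (sym lens) (IsDist-sym (shortest⇒IsDist q sq))
        signs′ : wsign p ≡ wsign q → wsign (reverse p) ≡ wsign (reverse q)
        signs′ signs = trans (wsign-reverse p) (trans signs (sym (wsign-reverse q)))

theorem2p9 : (n : ℕ) (σ : Fin n → Sign) → 3 ≤ n → DistCompat σ →
    (HasDim σ 1 ⇔
      ∃ (λ u → netDeg σ u ≡ 0ℤ ×
        (∀ k → 1 ≤ k → k ≤ n / 2 → ∀ v w → v ≢ w →
          IsDist σ u v k → IsDist σ u w k → SignsDiffer σ u v w)))
theorem2p9 zero σ ()
theorem2p9 (suc m) σ 3≤n dc = mk⇔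
  (λ dim → let (u , resolves) = hasDim1⇒∃resolves dim
           in u , signsDiffer₁⇒netDeg≡0 σ 3≤n u (resolves⇒signsDiffer dc resolves 1)
                , λ k _ _ → resolves⇒signsDiffer dc resolves k)
  (λ (u , _ , differ) → resolves⇒hasDim1 (next-≢ (<⇒≤ 3≤n) Fin.zero) (signsDiffer⇒resolves σ differ))
  where
  open Cycle m
  open Walks σ
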